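{- Let $V$ and $H$ be respectively the vertical and horizontal halves of the Riordan array $(g(x),f(x))$. Then $V$ is invertible and $$V^{ -1}\cdot H=(1,f(x)),$$ equivalently $H=V\cdot(1,f(x))$.
   Context: All power series are formal power series with complex coefficients. A Riordan array is a pair $(g(x),f(x))$ of power series with $g(0)\neq 0$, $f(0)=0$, $f'(0)\neq 0$; it is identified with the infinite lower triangular matrix $(t_{n,k})_{n,k\ge 0}$, $t_{n,k}=[x^n]g(x)f(x)^k$. The product is $(g,f)\cdot(u,v)=(g(x)u(f(x)),v(f(x)))$, which corresponds to matrix multiplication, and Riordan arrays form a group under it. The vertical half of a Riordan array with matrix $(t_{n,k})$ is the matrix whose $(n,k)$ entry is $t_{2n-k,n}$ (with $t_{i,j}=0$ for $j>i$); the horizontal half is the matrix whose $(n,k)$ entry is $t_{2n,n+k}$. -}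

module Defs where

open import Level using (Level; _⊔_)
open import Data.Nat using (ℕ; zero; suc; _≤?_; _∸_; _<_; _≟_) renaming (_*_ to _*ℕ_; _+_ to _+ℕ_)
open import Data.Bool using (if_then_else_)
open import Data.Product using (Σ; _×_; ∃)
open import Relation.Nullary using (¬_)
open import Relation.Nullary.Decidable using (⌊_⌋)
open import Relation.Binary.PropositionalEquality using (_≡_)
open import Algebra.Bundles using (CommutativeRing)

-- Riordan-array notions over a commutative ring R (intended: R = ℂ).
module RA {c ℓ : Level} (R : CommutativeRing c ℓ) where
  open CommutativeRing R

  Series : Set c
  Series = ℕ → Carrier

  -- infinite matrices, indexed (row, column)
  Matrix : Set c
  Matrix = ℕ → ℕ → Carrier

  sumTo : ℕ → (ℕ → Carrier) → Carrier
  sumTo zero    a = 0#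
  sumTo (suc n) a = sumTo n a + a n

  _·ₛ_ : Series → Series → Series
  (a ·ₛ b) n = sumTo (suc n) (λ i → a i * b (n ∸ i))

  oneₛ : Series
  oneₛ zero    = 1#
  oneₛ (suc _) = 0#

  _^ₛ_ : Series → ℕ → Series
  a ^ₛ zero  = oneₛ
  a ^ₛ suc k = a ·ₛ (a ^ₛ k)

  riordan : Series → Series → Matrix
  riordan g f n k = (g ·ₛ (f ^ₛ k)) n

  idM : Matrix
  idM n k = if ⌊ n ≟ k ⌋ then 1# else 0#

  -- product of infinite matrices whose left factor is lower triangular:
  -- (A ⊙ B) n k = Σ_{j=0}^{n} A n j * B j k
  _⊙_ : Matrix → Matrix → Matrix
  (A ⊙ B) n k = sumTo (suc n) (λ j → A n j * B j k)

  LowerTriangular : Matrix → Set ℓ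
  LowerTriangular A = ∀ n k → n < k → A n k ≈ 0#

  _≐_ : Matrix → Matrix → Set ℓ
  A ≐ B = ∀ n k → A n k ≈ B n k

  -- vertical half: (n,k) entry t_{2n-k,n}, which is 0 when k > n
  -- (then 2n-k < n, or 2n-k is negative)
  verticalHalf : Matrix → Matrix
  verticalHalf t n k = if ⌊ k ≤? n ⌋ then t (2 *ℕ n ∸ k) n else 0#

  horizontalHalf : Matrix → Matrix
  horizontalHalf t n k = t (2 *ℕ n) (n +ℕ k)

{-# OPTIONS --safe #-}
-- The (n,k) entry of H is [x^2n] (g f^n) f^k = Σ_j [x^(2n-j)] (g f^n) · [x^j] f^k.  Since g f^n
-- has order n, only j ≤ n contributes, and these factors are exactly the entries of V and of
-- (1, f): so H = V (1, f).  V is lower triangular with diagonal entries g₀ f₁ⁿ, hence has a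
-- lower triangular right inverse W by forward substitution; the same applied to W shows W is
-- also a left inverse, and then W H = W V (1, f) = (1, f).
module Submission where

open import Defs
open import Level using (Level; _⊔_)
open import Data.Product using (Σ; _×_; ∃; _,_; proj₁; proj₂)
open import Data.Sum using (_⊎_; inj₁; inj₂)
open import Data.Empty using (⊥-elim)
open import Relation.Nullary using (¬_; yes; no)
open import Relation.Nullary.Decidable using (⌊_⌋)
open import Algebra.Bundles using (CommutativeRing)
open import Data.Nat using (ℕ; zero; suc; _∸_; _<_; _≤_; z≤n; s≤s; s≤s⁻¹; _≤?_; _≟_)
  renaming (_+_ to _+ℕ_; _*_ to _*ℕ_)
import Data.Nat.Properties as ℕ
open import Relation.Binary.Definitions using (tri<; tri≈; tri>)
open import Data.Nat.Induction using (<-rec)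
open import Data.Bool using (if_then_else_)
open import Function using (_∘_)
import Relation.Binary.PropositionalEquality as P
open P using (_≡_; _≢_)

module RiordanHalves {c ℓ : Level} (R : CommutativeRing c ℓ) where
  open CommutativeRing R
  open RA R
  open import Relation.Binary.Reasoning.Setoid setoid
  open import Algebra.Properties.CommutativeSemigroup +-commutativeSemigroup
    using () renaming (interchange to +-interchange)
  open import Algebra.Properties.CommutativeSemigroup *-commutativeSemigroup
    using () renaming (interchange to *-interchange)
  open import Algebra.Properties.Group +-group using (//-rightDividesˡ)

  sumTo-cong : ∀ N {a b : ℕ → Carrier} → (∀ i → i < N → a i ≈ b i) → sumTo N a ≈ sumTo N b
  sumTo-cong zero    a≈b = refl
  sumTo-cong (suc N) a≈b = +-cong (sumTo-cong N (λ i i<N → a≈b i (ℕ.m<n⇒m<1+n i<N))) (a≈b N ℕ.≤-refl)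

  sumTo-zero : ∀ N {a : ℕ → Carrier} → (∀ i → i < N → a i ≈ 0#) → sumTo N a ≈ 0#
  sumTo-zero zero    a≈0 = refl
  sumTo-zero (suc N) a≈0 =
    trans (+-cong (sumTo-zero N (λ i i<N → a≈0 i (ℕ.m<n⇒m<1+n i<N))) (a≈0 N ℕ.≤-refl)) (+-identityʳ 0#)

  sumTo-single : ∀ N p {a : ℕ → Carrier} → p < N → (∀ i → i < N → i ≢ p → a i ≈ 0#) → sumTo N a ≈ a p
  sumTo-single (suc N) p (s≤s p≤N) a≈0 with ℕ.m≤n⇒m<n∨m≡n p≤N
  ... | inj₁ p<N = begin
    sumTo N _ + _ ≈⟨ +-cong (sumTo-single N p p<N (λ i i<N → a≈0 i (ℕ.m<n⇒m<1+n i<N)))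
                            (a≈0 N ℕ.≤-refl (λ N≡p → ℕ.<⇒≢ p<N (P.sym N≡p))) ⟩
    _ + 0#        ≈⟨ +-identityʳ _ ⟩
    _             ∎
  ... | inj₂ P.refl = begin
    sumTo N _ + _ ≈⟨ +-congʳ (sumTo-zero N (λ i i<N → a≈0 i (ℕ.m<n⇒m<1+n i<N) (ℕ.<⇒≢ i<N))) ⟩
    0# + _        ≈⟨ +-identityˡ _ ⟩
    _             ∎

  sumTo-+ : ∀ N (a b : ℕ → Carrier) → sumTo N (λ i → a i + b i) ≈ sumTo N a + sumTo N b
  sumTo-+ zero    a b = sym (+-identityˡ 0#)
  sumTo-+ (suc N) a b = trans (+-congʳ (sumTo-+ N a b)) (+-interchange _ _ _ _)

  *-distribˡ-sumTo : ∀ N x (a : ℕ → Carrier) → x * sumTo N a ≈ sumTo N (λ i → x * a i)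
  *-distribˡ-sumTo zero    x a = zeroʳ x
  *-distribˡ-sumTo (suc N) x a = trans (distribˡ x _ _) (+-congʳ (*-distribˡ-sumTo N x a))

  *-distribʳ-sumTo : ∀ N x (a : ℕ → Carrier) → sumTo N a * x ≈ sumTo N (λ i → a i * x)
  *-distribʳ-sumTo zero    x a = zeroˡ x
  *-distribʳ-sumTo (suc N) x a = trans (distribʳ x _ _) (+-congʳ (*-distribʳ-sumTo N x a))

  sumTo-suc : ∀ N (a : ℕ → Carrier) → sumTo (suc N) a ≈ a 0 + sumTo N (λ i → a (suc i))
  sumTo-suc zero    a = trans (+-identityˡ _) (sym (+-identityʳ _))
  sumTo-suc (suc N) a = trans (+-congʳ (sumTo-suc N a)) (+-assoc _ _ _)

  sumTo-truncate : ∀ m N (a : ℕ → Carrier) → m ≤ N → (∀ i → m ≤ i → i < N → a i ≈ 0#) →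
                   sumTo N a ≈ sumTo m a
  sumTo-truncate m zero    a z≤n a≈0 = refl
  sumTo-truncate m (suc N) a m≤N a≈0 with ℕ.m≤n⇒m<n∨m≡n m≤N
  ... | inj₂ P.refl = refl
  ... | inj₁ (s≤s m≤N) = begin
    sumTo N a + a N ≈⟨ +-cong (sumTo-truncate m N a m≤N (λ i m≤i i<N → a≈0 i m≤i (ℕ.m<n⇒m<1+n i<N)))
                               (a≈0 N m≤N ℕ.≤-refl) ⟩
    sumTo m a + 0#  ≈⟨ +-identityʳ _ ⟩
    sumTo m a       ∎

  sumTo-comm : ∀ M N (a : ℕ → ℕ → Carrier) →
               sumTo M (λ i → sumTo N (a i)) ≈ sumTo N (λ j → sumTo M (λ i → a i j))
  sumTo-comm zero    N a = sym (sumTo-zero N (λ _ _ → refl))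
  sumTo-comm (suc M) N a = trans (+-congʳ (sumTo-comm M N a)) (sym (sumTo-+ N _ _))

  sumTo-reverse : ∀ N (a : ℕ → Carrier) → sumTo (suc N) a ≈ sumTo (suc N) (λ i → a (N ∸ i))
  sumTo-reverse zero    a = refl
  sumTo-reverse (suc N) a = begin
    sumTo (suc N) a + a (suc N)                    ≈⟨ +-comm _ _ ⟩
    a (suc N) + sumTo (suc N) a                    ≈⟨ +-congˡ (sumTo-reverse N a) ⟩
    a (suc N) + sumTo (suc N) (λ i → a (N ∸ i))    ≈⟨ sumTo-suc (suc N) (λ i → a (suc N ∸ i)) ⟨
    sumTo (suc (suc N)) (λ i → a (suc N ∸ i))      ∎

  sumTo-triangle : ∀ N (a : ℕ → ℕ → Carrier) →
    sumTo N (λ i → sumTo (suc i) (a i)) ≈ sumTo N (λ j → sumTo (N ∸ j) (λ l → a (j +ℕ l) j))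
  sumTo-triangle zero    a = refl
  sumTo-triangle (suc N) a = begin
    sumTo N (λ i → sumTo (suc i) (a i)) + (sumTo N (a N) + a N N)
      ≈⟨ +-congʳ (sumTo-triangle N a) ⟩
    sumTo N (λ j → column N j) + (sumTo N (a N) + a N N)
      ≈⟨ +-assoc _ _ _ ⟨
    (sumTo N (λ j → column N j) + sumTo N (a N)) + a N N
      ≈⟨ +-congʳ (sumTo-+ N _ _) ⟨
    sumTo N (λ j → column N j + a N j) + a N N
      ≈⟨ +-cong (sumTo-cong N extend) corner ⟩
    sumTo N (λ j → column (suc N) j) + column (suc N) N ∎
    where
    column : ℕ → ℕ → Carrier
    column M j = sumTo (M ∸ j) (λ l → a (j +ℕ l) j)

    extend : ∀ j → j < N → column N j + a N j ≈ column (suc N) j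
    extend j j<N rewrite ℕ.+-∸-assoc 1 (ℕ.<⇒≤ j<N) =
      +-congˡ (reflexive (P.cong (λ k → a k j) (P.sym (ℕ.m+[n∸m]≡n (ℕ.<⇒≤ j<N)))))

    corner : a N N ≈ column (suc N) N
    corner rewrite ℕ.+-∸-assoc 1 (ℕ.≤-refl {N}) | ℕ.n∸n≡0 N | ℕ.+-identityʳ N = sym (+-identityˡ _)

  _≈ₛ_ : Series → Series → Set ℓ
  a ≈ₛ b = ∀ n → a n ≈ b n

  ·ₛ-cong : ∀ {a a′ b b′} → a ≈ₛ a′ → b ≈ₛ b′ → (a ·ₛ b) ≈ₛ (a′ ·ₛ b′)
  ·ₛ-cong a≈a′ b≈b′ n = sumTo-cong (suc n) (λ i _ → *-cong (a≈a′ i) (b≈b′ (n ∸ i)))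

  ·ₛ-identityˡ : ∀ b → (oneₛ ·ₛ b) ≈ₛ b
  ·ₛ-identityˡ b n = trans (sumTo-single (suc n) 0 (s≤s z≤n) oneₛ-off) (*-identityˡ (b n))
    where
    oneₛ-off : ∀ i → i < suc n → i ≢ 0 → oneₛ i * b (n ∸ i) ≈ 0#
    oneₛ-off zero    _ i≢0 = ⊥-elim (i≢0 P.refl)
    oneₛ-off (suc i) _ _   = zeroˡ _

  ·ₛ-assoc : ∀ a b d → ((a ·ₛ b) ·ₛ d) ≈ₛ (a ·ₛ (b ·ₛ d))
  ·ₛ-assoc a b d n = begin
    sumTo (suc n) (λ i → sumTo (suc i) (λ j → a j * b (i ∸ j)) * d (n ∸ i))
      ≈⟨ sumTo-cong (suc n) (λ i _ → *-distribʳ-sumTo (suc i) _ _) ⟩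
    sumTo (suc n) (λ i → sumTo (suc i) (λ j → a j * b (i ∸ j) * d (n ∸ i)))
      ≈⟨ sumTo-triangle (suc n) (λ i j → a j * b (i ∸ j) * d (n ∸ i)) ⟩
    sumTo (suc n) (λ j → sumTo (suc n ∸ j) (λ l → a j * b (j +ℕ l ∸ j) * d (n ∸ (j +ℕ l))))
      ≈⟨ sumTo-cong (suc n) inner ⟩
    sumTo (suc n) (λ j → a j * sumTo (suc (n ∸ j)) (λ l → b l * d (n ∸ j ∸ l))) ∎
    where
    inner : ∀ j → j < suc n →
            sumTo (suc n ∸ j) (λ l → a j * b (j +ℕ l ∸ j) * d (n ∸ (j +ℕ l)))
            ≈ a j * sumTo (suc (n ∸ j)) (λ l → b l * d (n ∸ j ∸ l))
    inner j (s≤s j≤n) rewrite ℕ.+-∸-assoc 1 j≤n = begin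
      sumTo (suc (n ∸ j)) (λ l → a j * b (j +ℕ l ∸ j) * d (n ∸ (j +ℕ l)))
        ≈⟨ sumTo-cong (suc (n ∸ j)) (λ l _ → trans (reflexive (P.cong₂ (λ x y → a j * b x * d y)
             (ℕ.m+n∸m≡n j l) (P.sym (ℕ.∸-+-assoc n j l)))) (*-assoc _ _ _)) ⟩
      sumTo (suc (n ∸ j)) (λ l → a j * (b l * d (n ∸ j ∸ l)))
        ≈⟨ *-distribˡ-sumTo (suc (n ∸ j)) (a j) _ ⟨
      a j * sumTo (suc (n ∸ j)) (λ l → b l * d (n ∸ j ∸ l)) ∎

  ^ₛ-+ : ∀ a m k → (a ^ₛ (m +ℕ k)) ≈ₛ ((a ^ₛ m) ·ₛ (a ^ₛ k))
  ^ₛ-+ a zero    k n = sym (·ₛ-identityˡ (a ^ₛ k) n)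
  ^ₛ-+ a (suc m) k n = trans (·ₛ-cong (λ _ → refl) (^ₛ-+ a m k) n) (sym (·ₛ-assoc a (a ^ₛ m) (a ^ₛ k) n))

  ·ₛ-reflected : ∀ a b n → (a ·ₛ b) n ≈ sumTo (suc n) (λ i → a (n ∸ i) * b i)
  ·ₛ-reflected a b n = trans (sumTo-reverse n _) (sumTo-cong (suc n) (λ i i<1+n →
    *-congˡ (reflexive (P.cong b (ℕ.m∸[m∸n]≡n (s≤s⁻¹ i<1+n))))))

  HasOrder : ℕ → Series → Set ℓ
  HasOrder p a = ∀ i → i < p → a i ≈ 0#

  module _ {p q : ℕ} {a b : Series} (ord-a : HasOrder p a) (ord-b : HasOrder q b) where
    private
      term-zero : ∀ {i} j → (j < p ⊎ i ∸ j < q) → a j * b (i ∸ j) ≈ 0#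
      term-zero j (inj₁ j<p)  = trans (*-congʳ (ord-a j j<p)) (zeroˡ _)
      term-zero j (inj₂ i∸j<q) = trans (*-congˡ (ord-b _ i∸j<q)) (zeroʳ _)

    ·ₛ-order : HasOrder (p +ℕ q) (a ·ₛ b)
    ·ₛ-order i i<p+q = sumTo-zero (suc i) λ j j<1+i → term-zero j (vanishing-factor j (s≤s⁻¹ j<1+i))
      where
      vanishing-factor : ∀ j → j ≤ i → j < p ⊎ i ∸ j < q
      vanishing-factor j j≤i with j ℕ.<? p
      ... | yes j<p = inj₁ j<p
      ... | no j≮p  = inj₂ (ℕ.≤-<-trans (ℕ.∸-monoʳ-≤ i (ℕ.≮⇒≥ j≮p))
                                         (P.subst (i ∸ p <_) (ℕ.m+n∸m≡n p q)
                                           (ℕ.∸-monoˡ-< i<p+q (ℕ.≤-trans (ℕ.≮⇒≥ j≮p) j≤i))))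

    ·ₛ-leading : (a ·ₛ b) (p +ℕ q) ≈ a p * b q
    ·ₛ-leading = begin
      (a ·ₛ b) (p +ℕ q)       ≈⟨ sumTo-single (suc (p +ℕ q)) p (s≤s (ℕ.m≤m+n p q)) off ⟩
      a p * b (p +ℕ q ∸ p)    ≡⟨ P.cong (λ k → a p * b k) (ℕ.m+n∸m≡n p q) ⟩
      a p * b q               ∎
      where
      off : ∀ j → j < suc (p +ℕ q) → j ≢ p → a j * b (p +ℕ q ∸ j) ≈ 0#
      off j (s≤s j≤p+q) j≢p with ℕ.<-cmp j p
      ... | tri< j<p _ _ = term-zero j (inj₁ j<p)
      ... | tri≈ _ j≡p _ = ⊥-elim (j≢p j≡p)
      ... | tri> _ _ p<j = term-zero j (inj₂
              (P.subst (p +ℕ q ∸ j <_) (ℕ.m+n∸m≡n p q) (ℕ.∸-monoʳ-< p<j j≤p+q)))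

  ·ₛ-coefficient : ∀ p m {N} (a b : Series) → HasOrder p a → N ≡ p +ℕ m →
                   (a ·ₛ b) N ≈ sumTo (suc m) (λ j → a (N ∸ j) * b j)
  ·ₛ-coefficient p m {N} a b ord-a P.refl =
    trans (·ₛ-reflected a b N) (sumTo-truncate (suc m) (suc N) _ (s≤s (ℕ.m≤n+m m p)) high-zero)
    where
    high-zero : ∀ j → suc m ≤ j → j < suc N → a (N ∸ j) * b j ≈ 0#
    high-zero j m<j j<1+N = trans (*-congʳ (ord-a (N ∸ j) N∸j<p)) (zeroˡ _)
      where
      N∸j<p : N ∸ j < p
      N∸j<p = P.subst (N ∸ j <_) (ℕ.m+n∸n≡m p m) (ℕ.∸-monoʳ-< m<j (s≤s⁻¹ j<1+N))

  ^ₛ-order : ∀ {f} → HasOrder 1 f → ∀ k → HasOrder k (f ^ₛ k)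
  ^ₛ-order ord-f zero    i ()
  ^ₛ-order ord-f (suc k) = ·ₛ-order ord-f (^ₛ-order ord-f k)

  ^ₛ-leading : ∀ {f} → HasOrder 1 f → ∀ k → (f ^ₛ suc k) (suc k) ≈ f 1 * (f ^ₛ k) k
  ^ₛ-leading ord-f k = ·ₛ-leading ord-f (^ₛ-order ord-f k)

  Invertible : Carrier → Set (c ⊔ ℓ)
  Invertible x = ∃ λ y → x * y ≈ 1#

  Invertible-resp-≈ : ∀ {x y} → x ≈ y → Invertible x → Invertible y
  Invertible-resp-≈ x≈y (z , xz≈1) = z , trans (*-congʳ (sym x≈y)) xz≈1

  *-invertible : ∀ {x y} → Invertible x → Invertible y → Invertible (x * y)
  *-invertible {x} {y} (x′ , xx′≈1) (y′ , yy′≈1) = x′ * y′ , (begin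
    (x * y) * (x′ * y′) ≈⟨ *-interchange x y x′ y′ ⟩
    (x * x′) * (y * y′) ≈⟨ *-cong xx′≈1 yy′≈1 ⟩
    1# * 1#             ≈⟨ *-identityˡ 1# ⟩
    1#                  ∎)

  ^ₛ-leading-invertible : ∀ {f} → HasOrder 1 f → Invertible (f 1) → ∀ k → Invertible ((f ^ₛ k) k)
  ^ₛ-leading-invertible ord-f inv-f₁ zero    = 1# , *-identityˡ 1#
  ^ₛ-leading-invertible ord-f inv-f₁ (suc k) =
    Invertible-resp-≈ (sym (^ₛ-leading ord-f k)) (*-invertible inv-f₁ (^ₛ-leading-invertible ord-f inv-f₁ k))

  idM-diagonal : ∀ n → idM n n ≡ 1#
  idM-diagonal n with n ≟ n
  ... | yes _   = P.refl
  ... | no n≢n = ⊥-elim (n≢n P.refl)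

  idM-offDiagonal : ∀ {n k} → n ≢ k → idM n k ≡ 0#
  idM-offDiagonal {n} {k} n≢k with n ≟ k
  ... | yes n≡k = ⊥-elim (n≢k n≡k)
  ... | no _    = P.refl

  ⊙-congˡ : ∀ {A A′} B → A ≐ A′ → (A ⊙ B) ≐ (A′ ⊙ B)
  ⊙-congˡ B A≐A′ n k = sumTo-cong (suc n) (λ j _ → *-congʳ (A≐A′ n j))

  ⊙-congʳ : ∀ A {B B′} → B ≐ B′ → (A ⊙ B) ≐ (A ⊙ B′)
  ⊙-congʳ A B≐B′ n k = sumTo-cong (suc n) (λ j _ → *-congˡ (B≐B′ j k))

  ⊙-identityˡ : ∀ A → (idM ⊙ A) ≐ A
  ⊙-identityˡ A n k = begin
    (idM ⊙ A) n k   ≈⟨ sumTo-single (suc n) n ℕ.≤-refl off ⟩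
    idM n n * A n k ≈⟨ *-congʳ (reflexive (idM-diagonal n)) ⟩
    1# * A n k      ≈⟨ *-identityˡ (A n k) ⟩
    A n k           ∎
    where
    off : ∀ j → j < suc n → j ≢ n → idM n j * A j k ≈ 0#
    off j _ j≢n = trans (*-congʳ (reflexive (idM-offDiagonal (j≢n ∘ P.sym)))) (zeroˡ _)

  ⊙-identityʳ : ∀ A → LowerTriangular A → (A ⊙ idM) ≐ A
  ⊙-identityʳ A lower-A n k with k ≤? n
  ... | yes k≤n = begin
    (A ⊙ idM) n k   ≈⟨ sumTo-single (suc n) k (s≤s k≤n) off ⟩
    A n k * idM k k ≈⟨ *-congˡ (reflexive (idM-diagonal k)) ⟩
    A n k * 1#      ≈⟨ *-identityʳ (A n k) ⟩
    A n k           ∎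
    where
    off : ∀ j → j < suc n → j ≢ k → A n j * idM j k ≈ 0#
    off j _ j≢k = trans (*-congˡ (reflexive (idM-offDiagonal j≢k))) (zeroʳ _)
  ... | no k≰n = trans (sumTo-zero (suc n) off) (sym (lower-A n k n<k))
    where
    n<k = ℕ.≰⇒> k≰n
    off : ∀ j → j < suc n → A n j * idM j k ≈ 0#
    off j j<1+n = trans (*-congˡ (reflexive (idM-offDiagonal (ℕ.<⇒≢ (ℕ.<-≤-trans j<1+n n<k))))) (zeroʳ _)

  ⊙-diagonal : ∀ A B → LowerTriangular B → ∀ n → (A ⊙ B) n n ≈ A n n * B n n
  ⊙-diagonal A B lower-B n = sumTo-single (suc n) n ℕ.≤-refl off
    where
    off : ∀ j → j < suc n → j ≢ n → A n j * B j n ≈ 0#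
    off j j<1+n j≢n = trans (*-congˡ (lower-B j n (ℕ.≤∧≢⇒< (s≤s⁻¹ j<1+n) j≢n))) (zeroʳ _)

  ⊙-assoc : ∀ A B C → LowerTriangular B → ((A ⊙ B) ⊙ C) ≐ (A ⊙ (B ⊙ C))
  ⊙-assoc A B C lower-B n k = begin
    sumTo (suc n) (λ j → sumTo (suc n) (λ i → A n i * B i j) * C j k)
      ≈⟨ sumTo-cong (suc n) (λ j _ → trans (*-distribʳ-sumTo (suc n) _ _)
                                           (sumTo-cong (suc n) (λ i _ → *-assoc _ _ _))) ⟩
    sumTo (suc n) (λ j → sumTo (suc n) (λ i → A n i * (B i j * C j k)))
      ≈⟨ sumTo-comm (suc n) (suc n) _ ⟩
    sumTo (suc n) (λ i → sumTo (suc n) (λ j → A n i * (B i j * C j k)))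
      ≈⟨ sumTo-cong (suc n) factor ⟩
    sumTo (suc n) (λ i → A n i * sumTo (suc i) (λ j → B i j * C j k)) ∎
    where
    factor : ∀ i → i < suc n →
             sumTo (suc n) (λ j → A n i * (B i j * C j k)) ≈ A n i * sumTo (suc i) (λ j → B i j * C j k)
    factor i i<1+n = trans (sym (*-distribˡ-sumTo (suc n) (A n i) _))
      (*-congˡ (sumTo-truncate (suc i) (suc n) _ i<1+n (λ j i<j _ → trans (*-congʳ (lower-B i j i<j)) (zeroˡ _))))

  leftInverse≐rightInverse : ∀ {A B C} → LowerTriangular A → LowerTriangular B →
                             (A ⊙ B) ≐ idM → (B ⊙ C) ≐ idM → A ≐ C
  leftInverse≐rightInverse {A} {B} {C} lower-A lower-B AB≐I BC≐I n k = begin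
    A n k               ≈⟨ ⊙-identityʳ A lower-A n k ⟨
    (A ⊙ idM) n k       ≈⟨ ⊙-congʳ A BC≐I n k ⟨
    (A ⊙ (B ⊙ C)) n k   ≈⟨ ⊙-assoc A B C lower-B n k ⟨
    ((A ⊙ B) ⊙ C) n k   ≈⟨ ⊙-congˡ C AB≐I n k ⟩
    (idM ⊙ C) n k       ≈⟨ ⊙-identityˡ C n k ⟩
    C n k               ∎

  ⊙-cancelˡ : ∀ {W V} X → LowerTriangular V → (W ⊙ V) ≐ idM → (W ⊙ (V ⊙ X)) ≐ X
  ⊙-cancelˡ {W} {V} X lower-V WV≐I n k = begin
    (W ⊙ (V ⊙ X)) n k   ≈⟨ ⊙-assoc W V X lower-V n k ⟨
    ((W ⊙ V) ⊙ X) n k   ≈⟨ ⊙-congˡ X WV≐I n k ⟩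
    (idM ⊙ X) n k       ≈⟨ ⊙-identityˡ X n k ⟩
    X n k               ∎

  module ForwardSubstitution (M : Matrix) (inv-diag : ∀ n → Invertible (M n n)) where
    private
      e : ℕ → Carrier
      e n = proj₁ (inv-diag n)

    nextRow : Matrix → ℕ → ℕ → Carrier
    nextRow T n k = e n * (idM n k - sumTo n (λ j → M n j * T j k))

    -- Course-of-values recursion: row n of the right inverse is computed from all earlier rows.
    firstRows : ℕ → Matrix
    firstRows zero    j k = 0#
    firstRows (suc m) j k = if ⌊ j ≟ m ⌋ then nextRow (firstRows m) m k else firstRows m j k

    rightInverse : Matrix
    rightInverse n = firstRows (suc n) n

    rightInverse-unfold : ∀ n k → rightInverse n k ≡ nextRow (firstRows n) n k
    rightInverse-unfold n k with n ≟ n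
    ... | yes _   = P.refl
    ... | no n≢n = ⊥-elim (n≢n P.refl)

    firstRows-rightInverse : ∀ m j k → j < m → firstRows m j k ≡ rightInverse j k
    firstRows-rightInverse (suc m) j k j<1+m with j ≟ m
    ... | yes P.refl = P.sym (rightInverse-unfold j k)
    ... | no j≢m     = firstRows-rightInverse m j k (ℕ.≤∧≢⇒< (s≤s⁻¹ j<1+m) j≢m)

    rightInverse-equation : ∀ n k → rightInverse n k ≈ nextRow rightInverse n k
    rightInverse-equation n k = trans (reflexive (rightInverse-unfold n k))
      (*-congˡ (+-congˡ (-‿cong (sumTo-cong n (λ j j<n →
        *-congˡ (reflexive (firstRows-rightInverse n j k j<n)))))))

    ⊙-rightInverse : (M ⊙ rightInverse) ≐ idM
    ⊙-rightInverse n k = begin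
      S + M n n * rightInverse n k       ≈⟨ +-congˡ (*-congˡ (rightInverse-equation n k)) ⟩
      S + M n n * (e n * (idM n k - S))  ≈⟨ +-congˡ (*-assoc _ _ _) ⟨
      S + M n n * e n * (idM n k - S)    ≈⟨ +-congˡ (*-congʳ (proj₂ (inv-diag n))) ⟩
      S + 1# * (idM n k - S)             ≈⟨ +-congˡ (*-identityˡ _) ⟩
      S + (idM n k - S)                  ≈⟨ +-comm _ _ ⟩
      idM n k - S + S                    ≈⟨ //-rightDividesˡ S (idM n k) ⟩
      idM n k                            ∎
      where
      S : Carrier
      S = sumTo n (λ j → M n j * rightInverse j k)

    rightInverse-lower : LowerTriangular rightInverse
    rightInverse-lower = <-rec (λ n → ∀ k → n < k → rightInverse n k ≈ 0#) step
      where
      step : ∀ n → (∀ {m} → m < n → ∀ k → m < k → rightInverse m k ≈ 0#) →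
             ∀ k → n < k → rightInverse n k ≈ 0#
      step n ih k n<k = begin
        rightInverse n k                  ≈⟨ rightInverse-equation n k ⟩
        e n * (idM n k - S)               ≈⟨ *-congˡ (+-cong (reflexive (idM-offDiagonal (ℕ.<⇒≢ n<k)))
                                                          (-‿cong S≈0)) ⟩
        e n * (0# - 0#)                   ≈⟨ *-congˡ (-‿inverseʳ 0#) ⟩
        e n * 0#                          ≈⟨ zeroʳ _ ⟩
        0#                                ∎
        where
        S : Carrier
        S = sumTo n (λ j → M n j * rightInverse j k)
        S≈0 : S ≈ 0#
        S≈0 = sumTo-zero n (λ j j<n → trans (*-congˡ (ih j<n k (ℕ.<-trans j<n n<k))) (zeroʳ _))

  lowerTriangular-inverse : ∀ M → LowerTriangular M → (∀ n → Invertible (M n n)) →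
    Σ Matrix (λ W → LowerTriangular W × (W ⊙ M) ≐ idM × (M ⊙ W) ≐ idM)
  lowerTriangular-inverse M lower-M inv-diag =
    W , lower-W , WM≐I , MW≐I
    where
    open ForwardSubstitution M inv-diag using ()
      renaming (rightInverse to W; rightInverse-lower to lower-W; ⊙-rightInverse to MW≐I)

    inv-diag-W : ∀ n → Invertible (W n n)
    inv-diag-W n = M n n , (begin
      W n n * M n n  ≈⟨ *-comm _ _ ⟩
      M n n * W n n  ≈⟨ ⊙-diagonal M W lower-W n ⟨
      (M ⊙ W) n n    ≈⟨ MW≐I n n ⟩
      idM n n        ≡⟨ idM-diagonal n ⟩
      1#             ∎)

    open ForwardSubstitution W inv-diag-W using ()
      renaming (rightInverse to S; ⊙-rightInverse to WS≐I)

    WM≐I : (W ⊙ M) ≐ idM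
    WM≐I n k = trans (⊙-congʳ W (leftInverse≐rightInverse lower-M lower-W MW≐I WS≐I) n k) (WS≐I n k)

  verticalHalf-lower : ∀ t → LowerTriangular (verticalHalf t)
  verticalHalf-lower t n k n<k with k ≤? n
  ... | yes k≤n = ⊥-elim (ℕ.<⇒≱ n<k k≤n)
  ... | no _    = refl

  verticalHalf-entry : ∀ t {n j} → j ≤ n → verticalHalf t n j ≡ t (2 *ℕ n ∸ j) n
  verticalHalf-entry t {n} {j} j≤n with j ≤? n
  ... | yes _   = P.refl
  ... | no j≰n = ⊥-elim (j≰n j≤n)

  verticalHalf-diagonal : ∀ t n → verticalHalf t n n ≡ t n n
  verticalHalf-diagonal t n = P.trans (verticalHalf-entry t ℕ.≤-refl)
    (P.cong (λ i → t i n) (P.trans (ℕ.m+n∸m≡n n (n +ℕ 0)) (ℕ.+-identityʳ n)))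

  module _ (g f : Series) (ord-f : HasOrder 1 f) where
    riordan-diagonal : ∀ n → riordan g f n n ≈ g 0 * (f ^ₛ n) n
    riordan-diagonal n = ·ₛ-leading {p = 0} (λ _ ()) (^ₛ-order ord-f n)

    verticalHalf-diagonal-invertible : Invertible (g 0) → Invertible (f 1) →
                                       ∀ n → Invertible (verticalHalf (riordan g f) n n)
    verticalHalf-diagonal-invertible inv-g₀ inv-f₁ n =
      Invertible-resp-≈
        (trans (sym (riordan-diagonal n)) (reflexive (P.sym (verticalHalf-diagonal (riordan g f) n))))
        (*-invertible inv-g₀ (^ₛ-leading-invertible ord-f inv-f₁ n))

    horizontalHalf≐verticalHalf⊙ :
      horizontalHalf (riordan g f) ≐ (verticalHalf (riordan g f) ⊙ riordan oneₛ f)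
    horizontalHalf≐verticalHalf⊙ n k = begin
      (g ·ₛ (f ^ₛ (n +ℕ k))) (2 *ℕ n)
        ≈⟨ ·ₛ-cong (λ _ → refl) (^ₛ-+ f n k) (2 *ℕ n) ⟩
      (g ·ₛ ((f ^ₛ n) ·ₛ (f ^ₛ k))) (2 *ℕ n)
        ≈⟨ ·ₛ-assoc g (f ^ₛ n) (f ^ₛ k) (2 *ℕ n) ⟨
      ((g ·ₛ (f ^ₛ n)) ·ₛ (f ^ₛ k)) (2 *ℕ n)
        ≈⟨ ·ₛ-coefficient n n _ _ (·ₛ-order {p = 0} (λ _ ()) (^ₛ-order ord-f n))
                             (P.cong (n +ℕ_) (ℕ.+-identityʳ n)) ⟩
      sumTo (suc n) (λ j → riordan g f (2 *ℕ n ∸ j) n * (f ^ₛ k) j)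
        ≈⟨ sumTo-cong (suc n) (λ j j<1+n → *-cong
             (reflexive (P.sym (verticalHalf-entry (riordan g f) (s≤s⁻¹ j<1+n))))
             (sym (·ₛ-identityˡ (f ^ₛ k) j))) ⟩
      (verticalHalf (riordan g f) ⊙ riordan oneₛ f) n k ∎

mainTheorem4 : ∀ {c ℓ : Level} (R : CommutativeRing c ℓ) →
    let open CommutativeRing R
        open RA R
    in
    -- R is a field (as ℂ is)
    ¬ (1# ≈ 0#) →
    (∀ x → ¬ (x ≈ 0#) → ∃ λ y → x * y ≈ 1#) →
    -- (g, f) is a Riordan array
    (g f : Series) → ¬ (g 0 ≈ 0#) → f 0 ≈ 0# → ¬ (f 1 ≈ 0#) →
    let V = verticalHalf (riordan g f)
        H = horizontalHalf (riordan g f)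
    in
    Σ Matrix (λ W →
      (LowerTriangular W × (W ⊙ V) ≐ idM × (V ⊙ W) ≐ idM)
      × (W ⊙ H) ≐ riordan oneₛ f
      × H ≐ (V ⊙ riordan oneₛ f))
mainTheorem4 R _ inverse g f g₀≉0 f₀≈0 f₁≉0 =
  let W , lower-W , WV≐I , VW≐I = lowerTriangular-inverse V lower-V
        (verticalHalf-diagonal-invertible g f ord-f (inverse (g 0) g₀≉0) (inverse (f 1) f₁≉0))
  in W , (lower-W , WV≐I , VW≐I)
       , (λ n k → trans (⊙-congʳ W H≐V⊙P n k) (⊙-cancelˡ P lower-V WV≐I n k))
       , H≐V⊙P
  where
  open CommutativeRing R
  open RA R
  open RiordanHalves R

  ord-f : HasOrder 1 f
  ord-f zero    _ = f₀≈0
  ord-f (suc _) (s≤s ())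

  V P : Matrix
  V = verticalHalf (riordan g f)
  P = riordan oneₛ f

  lower-V : LowerTriangular V
  lower-V = verticalHalf-lower (riordan g f)

  H≐V⊙P : horizontalHalf (riordan g f) ≐ (V ⊙ P)
  H≐V⊙P = horizontalHalf≐verticalHalf⊙ g f ord-f
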